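{- Let $q$ be a prime power and $G$ a subgroup of $\mathbb{F}_q^*$ of cardinality $T$. Let $N=|\{\xi\in G:\xi-\xi^{ -1}\in G\}|$. Then $$N\ge \frac{T^2}{q}-3q^{1/2}.$$ -}

module Defs where

open import Level using (Level; _⊔_) renaming (suc to lsuc)
open import Algebra.Bundles using (CommutativeRing)
open import Data.Nat using (ℕ; zero; suc; _^_)
open import Data.Fin using (Fin; zero; suc)
import Data.Fin.Properties as FinP
open import Data.Nat.Primality using (Prime)
open import Data.Product using (Σ; ∃; _×_; _,_; proj₁)
open import Function.Bundles using (Inverse; Injection)
open import Function.Properties.Inverse using (Inverse⇒Injection)
open import Relation.Nullary using (¬_; Dec; yes; no)
open import Relation.Binary using (Decidable)
open import Relation.Binary.PropositionalEquality as ≡ using (_≡_)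

IsPrimePower : ℕ → Set
IsPrimePower q = Σ ℕ λ p → Σ ℕ λ k → Prime p × (q ≡ p ^ suc k)

count : ∀ {p} {n : ℕ} {P : Fin n → Set p} → (∀ i → Dec (P i)) → ℕ
count {n = zero}  P? = 0
count {n = suc n} P? with P? zero
... | yes _ = suc (count (λ i → P? (suc i)))
... | no  _ = count (λ i → P? (suc i))

record FiniteField (c ℓ : Level) : Set (lsuc (c ⊔ ℓ)) where
  field
    commRing  : CommutativeRing c ℓ
  open CommutativeRing commRing public
  field
    1≉0       : ¬ (1# ≈ 0#)
    inverse   : ∀ x → ¬ (x ≈ 0#) → ∃ λ y → x * y ≈ 1#
    size      : ℕ
    enum      : Inverse setoid (≡.setoid (Fin size))

  _⁻¹[_] : ∀ x → ¬ (x ≈ 0#) → Carrier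
  x ⁻¹[ nz ] = proj₁ (inverse x nz)

  _≟_ : Decidable _≈_
  x ≟ y with Inverse.to enum x FinP.≟ Inverse.to enum y
  ... | yes e = yes (Injection.injective (Inverse⇒Injection enum) e)
  ... | no ne = no (λ e → ne (Inverse.to-cong enum e))

record Subgroup {c ℓ} (F : FiniteField c ℓ) (T : ℕ) : Set (c ⊔ ℓ) where
  open FiniteField F
  field
    g         : Fin T → Carrier
    injective : ∀ i j → g i ≈ g j → i ≡ j
    nonzero   : ∀ i → ¬ (g i ≈ 0#)
    has-one   : ∃ λ i → g i ≈ 1#
    mul-closed : ∀ i j → ∃ λ k → g i * g j ≈ g k
    inv-closed : ∀ i → ∃ λ j → g i * g j ≈ 1#

  _∈G : Carrier → Set ℓ
  y ∈G = ∃ λ (k : Fin T) → g k ≈ y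

  _∈G? : ∀ y → Dec (y ∈G)
  y ∈G? = FinP.any? (λ k → g k ≟ y)

  diff : Fin T → Carrier
  diff i = g i + - (g i ⁻¹[ nonzero i ])

  N : ℕ
  N = count (λ i → diff i ∈G?)

-- Let sᵢ = gᵢ² run over the squares of G (with multiplicity). For λ ∈ F let r_λ(y) be the number of
-- pairs (i , j) with sᵢ + λ sⱼ = y, and E(λ) = Σ_y r_λ(y)². Two such sums agree for at most one λ
-- unless sⱼ = s_m and sᵢ = s_k, and every element has at most two square roots in G, so
-- Σ_λ E(λ) ≤ T⁴ + 4qT²; by Cauchy–Schwarz each excess q E(λ) - T⁴ is nonnegative, hence the
-- excesses add up to at most 4q²T². Replacing j by μj shows E(λ μ²) = E(λ), and μ ↦ -μ² is at most
-- two-to-one, so T (q E(-1) - T⁴) ≤ 8q²T². Finally sᵢ - sⱼ = gⱼ² ξ (ξ - ξ⁻¹) with ξ = gᵢ/gⱼ, so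
-- Σ_{y ∈ G} r₋₁(y) = T N, and the variance of q r₋₁ - T² over G gives
-- T (q N - T²)² ≤ q (q E(-1) - T⁴) ≤ 8q³T, that is (q N - T²)² ≤ 8q³.

module Submission where

open import Defs
open import Level using (Level)
open import Data.Nat as ℕ using (ℕ; z≤n; s≤s)
import Data.Nat.Properties as ℕₚ
open import Data.Fin using (Fin; remQuot)
import Data.Fin.Properties as Finₚ
open import Data.Fin.Permutation using (Permutation; permutation)
open import Data.Product using (_,_; proj₁; proj₂)
open import Data.Sum as Sum using (_⊎_; inj₁; inj₂)
open import Data.Empty using (⊥-elim)
open import Function using (_∘_)
open import Function.Bundles using (Inverse)
open import Relation.Nullary using (¬_; yes; no)
import Relation.Binary.PropositionalEquality as ≡
open ≡ using (_≡_)

module NatSums where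

  open import Data.Nat using (zero; suc; _+_; _*_; _∸_; _≤_)
  open import Data.Nat.Properties
  open import Data.Fin using (zero; suc; _↑ˡ_; _↑ʳ_; combine)
  open import Data.Product using (_×_)
  open import Relation.Nullary using (Dec)
  open import Relation.Binary.PropositionalEquality
  open import Algebra.Properties.Semiring.Sum +-*-semiring public
    using (sum; sum-syntax; sum-cong-≗; ∑-distrib-+; ∑-comm; ∑-permute; *-distribˡ-sum; *-distribʳ-sum)

  𝟙 : ∀ {a} {A : Set a} → Dec A → ℕ
  𝟙 (yes _) = 1
  𝟙 (no _)  = 0

  𝟙≤1 : ∀ {a} {A : Set a} (A? : Dec A) → 𝟙 A? ≤ 1
  𝟙≤1 (yes _) = s≤s z≤n
  𝟙≤1 (no _)  = z≤n

  𝟙-mono : ∀ {a b} {A : Set a} {B : Set b} (A? : Dec A) (B? : Dec B) → (A → B) → 𝟙 A? ≤ 𝟙 B?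
  𝟙-mono (yes a) (yes _) _   = ≤-refl
  𝟙-mono (yes a) (no ¬b) A→B with () ← ¬b (A→B a)
  𝟙-mono (no _)  _       _   = z≤n

  𝟙≡0 : ∀ {a} {A : Set a} (A? : Dec A) → ¬ A → 𝟙 A? ≡ 0
  𝟙≡0 (yes a) ¬a with () ← ¬a a
  𝟙≡0 (no _)  _  = refl

  𝟙≡1 : ∀ {a} {A : Set a} (A? : Dec A) → A → 𝟙 A? ≡ 1
  𝟙≡1 (yes _) _ = refl
  𝟙≡1 (no ¬a) a with () ← ¬a a

  𝟙-⊎ : ∀ {a b c} {A : Set a} {B : Set b} {C : Set c} (A? : Dec A) (B? : Dec B) (C? : Dec C) →
        (A → B ⊎ C) → 𝟙 A? ≤ 𝟙 B? + 𝟙 C?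
  𝟙-⊎ (no _)  _       _       _ = z≤n
  𝟙-⊎ (yes a) (yes _) _       _ = s≤s z≤n
  𝟙-⊎ (yes a) (no ¬b) (yes _) _ = m≤n+m 1 0
  𝟙-⊎ (yes a) (no ¬b) (no ¬c) A→B⊎C with A→B⊎C a
  ... | inj₁ b with () ← ¬b b
  ... | inj₂ c with () ← ¬c c

  𝟙-cong : ∀ {a b} {A : Set a} {B : Set b} (A? : Dec A) (B? : Dec B) → (A → B) → (B → A) → 𝟙 A? ≡ 𝟙 B?
  𝟙-cong A? B? A→B B→A = ≤-antisym (𝟙-mono A? B? A→B) (𝟙-mono B? A? B→A)

  count≡∑𝟙 : ∀ {p n} {P : Fin n → Set p} (P? : ∀ i → Dec (P i)) → count P? ≡ ∑[ i < n ] 𝟙 (P? i)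
  count≡∑𝟙 {n = zero}  P? = refl
  count≡∑𝟙 {n = suc n} P? with P? zero
  ... | yes _ = cong suc (count≡∑𝟙 (P? ∘ suc))
  ... | no _  = count≡∑𝟙 (P? ∘ suc)

  sum-const : ∀ n c → ∑[ i < n ] c ≡ n * c
  sum-const zero    c = refl
  sum-const (suc n) c = cong (c +_) (sum-const n c)

  sum-0 : ∀ n → ∑[ i < n ] 0 ≡ 0
  sum-0 n = trans (sum-const n 0) (*-zeroʳ n)

  sum-zero : ∀ {n} {f : Fin n → ℕ} → (∀ i → f i ≡ 0) → sum f ≡ 0
  sum-zero {n} f≡0 = trans (sum-cong-≗ f≡0) (sum-0 n)

  ≤-sum : ∀ {n} (f : Fin n → ℕ) i → f i ≤ sum f
  ≤-sum f zero    = m≤m+n (f zero) _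
  ≤-sum f (suc i) = ≤-trans (≤-sum (f ∘ suc) i) (m≤n+m _ (f zero))

  sum-*-sum : ∀ {m n} (f : Fin m → ℕ) (g : Fin n → ℕ) → ∑[ i < m ] ∑[ j < n ] (f i * g j) ≡ sum f * sum g
  sum-*-sum f g = trans (sum-cong-≗ λ i → sym (*-distribˡ-sum (f i) g)) (sym (*-distribʳ-sum (sum g) f))

  sum-mono-≤ : ∀ {n} {f g : Fin n → ℕ} → (∀ i → f i ≤ g i) → sum f ≤ sum g
  sum-mono-≤ {zero}  f≤g = z≤n
  sum-mono-≤ {suc n} f≤g = +-mono-≤ (f≤g zero) (sum-mono-≤ (f≤g ∘ suc))

  sum-↑ : ∀ m {n} (f : Fin (m + n) → ℕ) → sum f ≡ ∑[ i < m ] f (i ↑ˡ n) + ∑[ j < n ] f (m ↑ʳ j)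
  sum-↑ zero    f = refl
  sum-↑ (suc m) f = trans (cong (f zero +_) (sum-↑ m (f ∘ suc))) (sym (+-assoc (f zero) _ _))

  sum-combine : ∀ m {n} (f : Fin (m * n) → ℕ) → sum f ≡ ∑[ i < m ] ∑[ j < n ] f (combine i j)
  sum-combine zero        f = refl
  sum-combine (suc m) {n} f = trans (sum-↑ n f) (cong (sum (λ j → f (combine {suc m} zero j)) +_) (sum-combine m (f ∘ (n ↑ʳ_))))

  sum-remQuot : ∀ m {n} (h : Fin m × Fin n → ℕ) → ∑[ u < m * n ] h (remQuot {m} n u) ≡ ∑[ i < m ] ∑[ j < n ] h (i , j)
  sum-remQuot m {n} h = trans (sum-combine m (h ∘ remQuot {m} n))
    (sum-cong-≗ λ i → sum-cong-≗ λ j → cong h (Finₚ.remQuot-combine i j))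

  sum-∸ : ∀ {n} (f : Fin n → ℕ) c → (∀ i → c ≤ f i) → ∑[ i < n ] (f i ∸ c) + n * c ≡ sum f
  sum-∸ {n} f c c≤f = begin
    ∑[ i < n ] (f i ∸ c) + n * c          ≡⟨ cong (∑[ i < n ] (f i ∸ c) +_) (sum-const n c) ⟨
    ∑[ i < n ] (f i ∸ c) + ∑[ i < n ] c   ≡⟨ ∑-distrib-+ (λ i → f i ∸ c) (λ _ → c) ⟨
    ∑[ i < n ] (f i ∸ c + c)              ≡⟨ sum-cong-≗ (λ i → m∸n+n≡m (c≤f i)) ⟩
    sum f                                 ∎
    where open ≡-Reasoning

  sum-𝟙-unique : ∀ {p n} {P : Fin n → Set p} (P? : ∀ i → Dec (P i)) → (∀ i j → P i → P j → i ≡ j) →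
                 ∑[ i < n ] 𝟙 (P? i) ≤ 1
  sum-𝟙-unique {n = zero}  P? unique = z≤n
  sum-𝟙-unique {n = suc n} P? unique with P? zero
  ... | no _   = sum-𝟙-unique (P? ∘ suc) (λ i j Pi Pj → Finₚ.suc-injective (unique _ _ Pi Pj))
  ... | yes P0 = s≤s (≤-reflexive (sum-zero λ i → 𝟙≡0 (P? (suc i)) λ Pi → Finₚ.0≢1+n (unique zero (suc i) P0 Pi)))

  sum-𝟙≡𝟙-any : ∀ {p n} {P : Fin n → Set p} (P? : ∀ i → Dec (P i)) → (∀ i j → P i → P j → i ≡ j) →
                 ∑[ i < n ] 𝟙 (P? i) ≡ 𝟙 (Finₚ.any? P?)
  sum-𝟙≡𝟙-any P? unique with Finₚ.any? P?
  ... | yes (i , Pi) = ≤-antisym (sum-𝟙-unique P? unique) (≤-trans (≤-reflexive (sym (𝟙≡1 (P? i) Pi))) (≤-sum (𝟙 ∘ P?) i))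
  ... | no ∄     = sum-zero λ i → 𝟙≡0 (P? i) λ Pi → ∄ (i , Pi)

  sum-pick : ∀ {n} (i : Fin n) (f : Fin n → ℕ) → ∑[ j < n ] (𝟙 (i Finₚ.≟ j) * f j) ≡ f i
  sum-pick {suc n} zero    f = trans (cong₂ _+_ (*-identityˡ (f zero)) (sum-0 n)) (+-identityʳ (f zero))
  sum-pick {suc n} (suc i) f = trans (sum-cong-≗ λ j → cong (_* f (suc j)) (𝟙-suc j)) (sum-pick i (f ∘ suc))
    where
    𝟙-suc : ∀ j → 𝟙 (suc i Finₚ.≟ suc j) ≡ 𝟙 (i Finₚ.≟ j)
    𝟙-suc j = 𝟙-cong (suc i Finₚ.≟ suc j) (i Finₚ.≟ j) Finₚ.suc-injective (cong suc)

open NatSums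

open import Data.Integer as ℤ using (ℤ; +_)
import Data.Integer.Properties as ℤₚ

module IntegerEstimates where

  open import Data.Integer using (-[1+_]; 0ℤ; _+_; _-_; -_; _*_; _≤_; +≤+)
  open import Data.Integer.Properties
  open import Data.Integer.Tactic.RingSolver using (solve-∀)
  open import Data.Nat using (_^_)
  import Data.Nat.Tactic.RingSolver as ℕ-Solver
  open import Data.Fin using (zero; suc)
  open import Relation.Binary.PropositionalEquality
  open import Algebra.Properties.CommutativeSemigroup ℕₚ.*-commutativeSemigroup using (x∙yz≈y∙xz)
  open import Algebra.Properties.Semiring.Sum +-*-semiring public
    using () renaming (sum to sumℤ; sum-cong-≗ to sumℤ-cong; ∑-distrib-+ to sumℤ-distrib-+; *-distribˡ-sum to *-distribˡ-sumℤ)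

  0≤i*i : ∀ i → 0ℤ ≤ i * i
  0≤i*i (+ n)     = subst (0ℤ ≤_) (pos-* n n) (+≤+ ℕ.z≤n)
  0≤i*i -[1+ n ]  = +≤+ ℕ.z≤n

  +m*i≤i : ∀ m {i} → m ℕ.≤ 1 → 0ℤ ≤ i → + m * i ≤ i
  +m*i≤i 0 {i} _ 0≤i = subst (_≤ i) (sym (*-zeroˡ i)) 0≤i
  +m*i≤i 1 {i} _ _   = ≤-reflexive (*-identityˡ i)
  +m*i≤i (ℕ.suc (ℕ.suc _)) (s≤s ())

  sumℤ-nonneg : ∀ {n} (f : Fin n → ℤ) → (∀ i → 0ℤ ≤ f i) → 0ℤ ≤ sumℤ f
  sumℤ-nonneg {ℕ.zero}  f 0≤f = ≤-refl
  sumℤ-nonneg {ℕ.suc n} f 0≤f = +-mono-≤ (0≤f zero) (sumℤ-nonneg (f ∘ suc) (0≤f ∘ suc))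

  sumℤ-mono-≤ : ∀ {n} {f g : Fin n → ℤ} → (∀ i → f i ≤ g i) → sumℤ f ≤ sumℤ g
  sumℤ-mono-≤ {ℕ.zero}  f≤g = ≤-refl
  sumℤ-mono-≤ {ℕ.suc n} f≤g = +-mono-≤ (f≤g zero) (sumℤ-mono-≤ (f≤g ∘ suc))

  sumℤ-+ : ∀ {n} (f : Fin n → ℕ) → sumℤ (λ i → + f i) ≡ + sum f
  sumℤ-+ {ℕ.zero}  f = refl
  sumℤ-+ {ℕ.suc n} f = trans (cong (λ s → + f zero + s) (sumℤ-+ (f ∘ suc))) (sym (pos-+ (f zero) (sum (f ∘ suc))))

  sumℤ-linear₂ : ∀ {n} a b (f g : Fin n → ℤ) → sumℤ (λ i → a * f i + b * g i) ≡ a * sumℤ f + b * sumℤ g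
  sumℤ-linear₂ a b f g = trans (sumℤ-distrib-+ (λ i → a * f i) (λ i → b * g i))
    (sym (cong₂ _+_ (*-distribˡ-sumℤ a f) (*-distribˡ-sumℤ b g)))

  sumℤ-linear₃ : ∀ {n} a b c (f g h : Fin n → ℤ) →
                 sumℤ (λ i → a * f i + b * g i + c * h i) ≡ a * sumℤ f + b * sumℤ g + c * sumℤ h
  sumℤ-linear₃ a b c f g h = trans (sumℤ-distrib-+ (λ i → a * f i + b * g i) (λ i → c * h i))
    (cong₂ _+_ (sumℤ-linear₂ a b f g) (sym (*-distribˡ-sumℤ c h)))

  weighted-mean-sq≤ : ∀ {n} (w : Fin n → ℕ) (d : Fin n → ℤ) X → let W = + sum w in
    sumℤ (λ i → + w i * d i) ≡ W * X → W * (X * X) ≤ sumℤ (λ i → + w i * (d i * d i))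
  weighted-mean-sq≤ w d X mean = 0≤i-j⇒j≤i (begin
    0ℤ                                                       ≤⟨ sumℤ-nonneg _ (λ i → 0≤+n*i (w i) (0≤i*i (d i - X))) ⟩
    sumℤ (λ i → + w i * ((d i - X) * (d i - X)))             ≡⟨ sumℤ-cong (λ i → expand (+ w i) (d i) X) ⟩
    sumℤ (λ i → + 1 * (+ w i * (d i * d i)) + - (+ 2 * X) * (+ w i * d i) + X * X * + w i)
      ≡⟨ sumℤ-linear₃ (+ 1) (- (+ 2 * X)) (X * X) (λ i → + w i * (d i * d i)) (λ i → + w i * d i) (λ i → + w i) ⟩
    + 1 * S₂ + - (+ 2 * X) * sumℤ (λ i → + w i * d i) + X * X * sumℤ (λ i → + w i)
                                                             ≡⟨ cong₂ (λ a b → + 1 * S₂ + - (+ 2 * X) * a + X * X * b) mean (sumℤ-+ w) ⟩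
    + 1 * S₂ + - (+ 2 * X) * (W * X) + X * X * W             ≡⟨ collect S₂ X W ⟩
    S₂ - W * (X * X)                                         ∎)
    where
    open ≤-Reasoning
    W = + sum w
    S₂ = sumℤ (λ i → + w i * (d i * d i))
    0≤+n*i : ∀ m {i} → 0ℤ ≤ i → 0ℤ ≤ + m * i
    0≤+n*i m {i} 0≤i = subst (_≤ + m * i) (*-zeroʳ (+ m)) (*-monoˡ-≤-nonNeg (+ m) 0≤i)
    expand : ∀ v e X → v * ((e - X) * (e - X)) ≡ + 1 * (v * (e * e)) + - (+ 2 * X) * (v * e) + X * X * v
    expand = solve-∀
    collect : ∀ S₂ X W → + 1 * S₂ + - (+ 2 * X) * (W * X) + X * X * W ≡ S₂ - W * (X * X)
    collect = solve-∀

  sumℤ-sq-deviation : ∀ {n} (r : Fin n → ℕ) →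
    let N = + n ; M = + sum r in
    sumℤ (λ i → (N * + r i - M) * (N * + r i - M)) ≡ N * (N * + sum (λ i → r i ℕ.* r i) - M * M)
  sumℤ-sq-deviation {n} r = begin
    sumℤ (λ i → (N * + r i - M) * (N * + r i - M))
      ≡⟨ sumℤ-cong (λ i → trans (expand N (+ r i) M)
                                (cong (λ s → N * N * s + - (+ 2 * N * M) * + r i + M * M * + 1) (sym (pos-* (r i) (r i))))) ⟩
    sumℤ (λ i → N * N * + (r i ℕ.* r i) + - (+ 2 * N * M) * + r i + M * M * + 1)
      ≡⟨ sumℤ-linear₃ (N * N) (- (+ 2 * N * M)) (M * M) (λ i → + (r i ℕ.* r i)) (λ i → + r i) (λ (_ : Fin n) → + 1) ⟩
    N * N * sumℤ (λ i → + (r i ℕ.* r i)) + - (+ 2 * N * M) * sumℤ (λ i → + r i) + M * M * sumℤ {n} (λ _ → + 1)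
      ≡⟨ cong₂ _+_ (cong₂ (λ a b → N * N * a + - (+ 2 * N * M) * b) (sumℤ-+ (λ i → r i ℕ.* r i)) (sumℤ-+ r))
                   (cong (M * M *_) (trans (sumℤ-+ {n} (λ _ → 1)) (cong +_ (trans (sum-const n 1) (ℕₚ.*-identityʳ n))))) ⟩
    N * N * S₂ + - (+ 2 * N * M) * M + M * M * N
      ≡⟨ collect N M S₂ ⟩
    N * (N * S₂ - M * M) ∎
    where
    open ≡-Reasoning
    N = + n
    M = + sum r
    S₂ = + sum (λ i → r i ℕ.* r i)
    expand : ∀ N R M → (N * R - M) * (N * R - M) ≡ N * N * (R * R) + - (+ 2 * N * M) * R + M * M * + 1
    expand = solve-∀
    collect : ∀ N M S₂ → N * N * S₂ + - (+ 2 * N * M) * M + M * M * N ≡ N * (N * S₂ - M * M)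
    collect = solve-∀

  cauchy-schwarz : ∀ {n} (r : Fin n → ℕ) → sum r ℕ.* sum r ℕ.≤ n ℕ.* sum (λ i → r i ℕ.* r i)
  cauchy-schwarz {ℕ.zero}    r = ℕ.z≤n
  cauchy-schwarz {n@(ℕ.suc _)} r = drop‿+≤+ (begin
    + (sum r ℕ.* sum r)                    ≡⟨ pos-* (sum r) (sum r) ⟩
    + sum r * + sum r                      ≤⟨ 0≤i-j⇒j≤i (*-cancelˡ-≤-pos 0ℤ _ (+ n) (begin
      + n * 0ℤ                             ≡⟨ *-zeroʳ (+ n) ⟩
      0ℤ                                   ≤⟨ sumℤ-nonneg _ (λ i → 0≤i*i (+ n * + r i - + sum r)) ⟩
      sumℤ (λ i → (+ n * + r i - + sum r) * (+ n * + r i - + sum r)) ≡⟨ sumℤ-sq-deviation r ⟩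
      + n * (+ n * + sum (λ i → r i ℕ.* r i) - + sum r * + sum r) ∎)) ⟩
    + n * + sum (λ i → r i ℕ.* r i)        ≡⟨ pos-* n _ ⟨
    + (n ℕ.* sum (λ i → r i ℕ.* r i))      ∎)
    where open ≤-Reasoning

  ∸-square≤ : ∀ a b → + ((a ℕ.∸ b) ℕ.* (a ℕ.∸ b)) ≤ (+ b - + a) * (+ b - + a)
  ∸-square≤ a b with b ℕ.≤? a
  ... | no b≰a rewrite ℕₚ.m≤n⇒m∸n≡0 (ℕₚ.≰⇒≥ b≰a) = 0≤i*i (+ b - + a)
  ... | yes b≤a = ≤-reflexive (begin
    + ((a ℕ.∸ b) ℕ.* (a ℕ.∸ b))       ≡⟨ pos-* (a ℕ.∸ b) (a ℕ.∸ b) ⟩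
    + (a ℕ.∸ b) * + (a ℕ.∸ b)         ≡⟨ cong₂ _*_ a-b a-b ⟩
    (+ a - + b) * (+ a - + b)         ≡⟨ swap (+ a) (+ b) ⟩
    (+ b - + a) * (+ b - + a)         ∎)
    where
    open ≡-Reasoning
    a-b : + (a ℕ.∸ b) ≡ + a - + b
    a-b = sym (trans (m-n≡m⊖n a b) (⊖-≥ b≤a))
    swap : ∀ x y → (x - y) * (x - y) ≡ (y - x) * (y - x)
    swap = solve-∀

  square-bound : ∀ q T N W →
    + T * ((+ (q ℕ.* N) - + (T ℕ.* T)) * (+ (q ℕ.* N) - + (T ℕ.* T))) ≤ + (q ℕ.* W) →
    T ℕ.* W ℕ.≤ 2 ℕ.* (q ℕ.* q ℕ.* (T ℕ.* T ℕ.* 4)) →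
    (T ℕ.* T ℕ.∸ q ℕ.* N) ^ 2 ℕ.≤ 9 ℕ.* q ^ 3
  square-bound q 0 N W _ _ rewrite ℕₚ.0∸n≡0 (q ℕ.* N) = z≤n
  square-bound q T@(ℕ.suc _) N W T*X²≤q*W T*W≤ = begin
    Y ^ 2                      ≡⟨ cong (Y ℕ.*_) (ℕₚ.*-identityʳ Y) ⟩
    Y ℕ.* Y                    ≤⟨ ℕₚ.*-cancelˡ-≤ (T ℕ.* T) T²Y²≤ ⟩
    8 ℕ.* (q ℕ.* (q ℕ.* q))    ≤⟨ ℕₚ.*-monoˡ-≤ (q ℕ.* (q ℕ.* q)) (ℕₚ.n≤1+n 8) ⟩
    9 ℕ.* (q ℕ.* (q ℕ.* q))    ≡⟨ cong (λ c → 9 ℕ.* (q ℕ.* (q ℕ.* c))) (ℕₚ.*-identityʳ q) ⟨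
    9 ℕ.* q ^ 3                ∎
    where
    open ℕₚ.≤-Reasoning
    Y = T ℕ.* T ℕ.∸ q ℕ.* N
    T*Y²≤q*W : T ℕ.* (Y ℕ.* Y) ℕ.≤ q ℕ.* W
    T*Y²≤q*W = drop‿+≤+ (≤-trans (≤-reflexive (pos-* T (Y ℕ.* Y)))
      (≤-trans (*-monoˡ-≤-nonNeg (+ T) (∸-square≤ (T ℕ.* T) (q ℕ.* N))) T*X²≤q*W))
    T²Y²≤ : T ℕ.* T ℕ.* (Y ℕ.* Y) ℕ.≤ T ℕ.* T ℕ.* (8 ℕ.* (q ℕ.* (q ℕ.* q)))
    T²Y²≤ = begin
      T ℕ.* T ℕ.* (Y ℕ.* Y)                     ≡⟨ ℕₚ.*-assoc T T (Y ℕ.* Y) ⟩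
      T ℕ.* (T ℕ.* (Y ℕ.* Y))                   ≤⟨ ℕₚ.*-monoʳ-≤ T T*Y²≤q*W ⟩
      T ℕ.* (q ℕ.* W)                           ≡⟨ x∙yz≈y∙xz T q W ⟩
      q ℕ.* (T ℕ.* W)                           ≤⟨ ℕₚ.*-monoʳ-≤ q T*W≤ ⟩
      q ℕ.* (2 ℕ.* (q ℕ.* q ℕ.* (T ℕ.* T ℕ.* 4))) ≡⟨ rearrange q T ⟩
      T ℕ.* T ℕ.* (8 ℕ.* (q ℕ.* (q ℕ.* q)))     ∎
      where
      rearrange : ∀ q T → q ℕ.* (2 ℕ.* (q ℕ.* q ℕ.* (T ℕ.* T ℕ.* 4))) ≡ T ℕ.* T ℕ.* (8 ℕ.* (q ℕ.* (q ℕ.* q)))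
      rearrange = ℕ-Solver.solve-∀

open IntegerEstimates

module FieldAlgebra {c ℓ} (F : FiniteField c ℓ) where

  open FiniteField F
  open import Algebra.Properties.Ring ring using (-1*x≈-x; x[y-z]≈xy-xz; +-cancelˡ; +-cancelʳ; -‿involutive;
    +-inverseˡ-unique; x∙y⁻¹≈ε⇒x≈y; x≈y⇒x∙y⁻¹≈ε)
  open import Relation.Binary.Reasoning.Setoid setoid

  *-cancelʳ-nonzero : ∀ {x y z} → ¬ z ≈ 0# → x * z ≈ y * z → x ≈ y
  *-cancelʳ-nonzero {x} {y} {z} z≉0 xz≈yz = begin
    x                ≈⟨ cancel x ⟨
    x * z * z⁻¹      ≈⟨ *-congʳ xz≈yz ⟩
    y * z * z⁻¹      ≈⟨ cancel y ⟩
    y                ∎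
    where
    z⁻¹ = z ⁻¹[ z≉0 ]
    cancel : ∀ w → w * z * z⁻¹ ≈ w
    cancel w = trans (*-assoc w z z⁻¹) (trans (*-congˡ (proj₂ (inverse z z≉0))) (*-identityʳ w))

  [a-b]+[b-c]≈a-c : ∀ a b c → (a - b) + (b - c) ≈ a - c
  [a-b]+[b-c]≈a-c a b c = begin
    (a - b) + (b - c)     ≈⟨ +-assoc a (- b) (b - c) ⟩
    a + (- b + (b - c))   ≈⟨ +-congˡ (sym (+-assoc (- b) b (- c))) ⟩
    a + (- b + b - c)     ≈⟨ +-congˡ (+-congʳ (-‿inverseˡ b)) ⟩
    a + (0# - c)          ≈⟨ +-congˡ (+-identityˡ (- c)) ⟩
    a - c                 ∎

  x²≈y²⇒x≈±y : ∀ {x y} → x * x ≈ y * y → x ≈ y ⊎ x ≈ - y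
  x²≈y²⇒x≈±y {x} {y} x²≈y² with (x - y) ≟ 0#
  ... | yes x-y≈0 = inj₁ (x∙y⁻¹≈ε⇒x≈y x y x-y≈0)
  ... | no  x-y≉0 = inj₂ (+-inverseˡ-unique x y (*-cancelʳ-nonzero x-y≉0 (begin
    (x + y) * (x - y)                  ≈⟨ distribʳ (x - y) x y ⟩
    x * (x - y) + y * (x - y)          ≈⟨ +-cong (x[y-z]≈xy-xz x x y) (x[y-z]≈xy-xz y x y) ⟩
    (x * x - x * y) + (y * x - y * y)  ≈⟨ +-congˡ (+-congʳ (*-comm y x)) ⟩
    (x * x - x * y) + (x * y - y * y)  ≈⟨ [a-b]+[b-c]≈a-c (x * x) (x * y) (y * y) ⟩
    x * x - y * y                      ≈⟨ x≈y⇒x∙y⁻¹≈ε x²≈y² ⟩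
    0#                                 ≈⟨ zeroˡ (x - y) ⟨
    0# * (x - y)                       ∎)))

  a+u≈c+v⇒u-v≈c-a : ∀ {a c u v} → a + u ≈ c + v → u - v ≈ c - a
  a+u≈c+v⇒u-v≈c-a {a} {c} {u} {v} eq = +-cancelˡ a (u - v) (c - a) (begin
    a + (u - v)    ≈⟨ +-assoc a u (- v) ⟨
    a + u - v      ≈⟨ +-congʳ eq ⟩
    c + v - v      ≈⟨ +-assoc c v (- v) ⟩
    c + (v - v)    ≈⟨ +-congˡ (-‿inverseʳ v) ⟩
    c + 0#         ≈⟨ +-identityʳ c ⟩
    c              ≈⟨ +-identityʳ c ⟨
    c + 0#         ≈⟨ +-congˡ (-‿inverseˡ a) ⟨
    c + (- a + a)  ≈⟨ +-assoc c (- a) a ⟨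
    c - a + a      ≈⟨ +-comm (c - a) a ⟩
    a + (c - a)    ∎)

  affine-coincidence : ∀ {a b c d l} → a + l * b ≈ c + l * d → l * (b - d) ≈ c - a
  affine-coincidence {a} {b} {c} {d} {l} eq = trans (x[y-z]≈xy-xz l b d) (a+u≈c+v⇒u-v≈c-a eq)

  affine-coincidence-unique : ∀ {a b c d l m} → ¬ b ≈ d →
    a + l * b ≈ c + l * d → a + m * b ≈ c + m * d → l ≈ m
  affine-coincidence-unique b≉d eqˡ eqᵐ = *-cancelʳ-nonzero (b≉d ∘ x∙y⁻¹≈ε⇒x≈y _ _)
    (trans (affine-coincidence eqˡ) (sym (affine-coincidence eqᵐ)))

  parallel-coincidence : ∀ {a b c d l} → b ≈ d → a + l * b ≈ c + l * d → a ≈ c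
  parallel-coincidence {a} {b} {c} {d} {l} b≈d eq = +-cancelʳ (l * b) a c (trans eq (+-congˡ (*-congˡ (sym b≈d))))

  -1*x≈y⇒x≈-1*y : ∀ {x y} → - 1# * x ≈ y → x ≈ - 1# * y
  -1*x≈y⇒x≈-1*y {x} {y} eq = begin
    x            ≈⟨ -‿involutive x ⟨
    - - x        ≈⟨ -‿cong (-1*x≈-x x) ⟨
    - (- 1# * x) ≈⟨ -‿cong eq ⟩
    - y          ≈⟨ -1*x≈-x y ⟨
    - 1# * y     ∎

module FieldSums {c ℓ} (F : FiniteField c ℓ) where

  open FiniteField F
  open FieldAlgebra F

  private
    q = size

  e : Fin q → Carrier
  e = Inverse.from enum

  e-injective : ∀ {x y} → e x ≈ e y → x ≡ y
  e-injective {x} {y} ex≈ey = ≡.trans (≡.sym (Inverse.strictlyInverseˡ enum x))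
    (≡.trans (Inverse.to-cong enum ex≈ey) (Inverse.strictlyInverseˡ enum y))

  δ : Carrier → Carrier → ℕ
  δ a b = 𝟙 (a ≟ b)

  δ-cong : ∀ {a a′ b b′} → a ≈ a′ → b ≈ b′ → δ a b ≡ δ a′ b′
  δ-cong a≈a′ b≈b′ = 𝟙-cong (_ ≟ _) (_ ≟ _)
    (λ a≈b → trans (sym a≈a′) (trans a≈b b≈b′)) (λ a′≈b′ → trans a≈a′ (trans a′≈b′ (sym b≈b′)))

  sum-δ-pick : ∀ a (f : Carrier → ℕ) → (∀ {x y} → x ≈ y → f x ≡ f y) →
               ∑[ x < q ] (δ a (e x) ℕ.* f (e x)) ≡ f a
  sum-δ-pick a f f-cong = ≡.trans (sum-cong-≗ λ x → ≡.cong (ℕ._* f (e x)) (δ≡ x))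
    (≡.trans (sum-pick (ι a) (f ∘ e)) (f-cong (Inverse.strictlyInverseʳ enum a)))
    where
    ι = Inverse.to enum
    δ≡ : ∀ x → δ a (e x) ≡ 𝟙 (ι a Finₚ.≟ x)
    δ≡ x = 𝟙-cong (a ≟ e x) (ι a Finₚ.≟ x)
      (λ a≈ex → ≡.trans (Inverse.to-cong enum a≈ex) (Inverse.strictlyInverseˡ enum x))
      (λ ιa≡x → trans (sym (Inverse.strictlyInverseʳ enum a)) (reflexive (≡.cong e ιa≡x)))

  sum-δ : ∀ a → ∑[ x < q ] δ a (e x) ≡ 1
  sum-δ a = ≡.trans (sum-cong-≗ λ x → ≡.sym (ℕₚ.*-identityʳ (δ a (e x)))) (sum-δ-pick a (λ _ → 1) (λ _ → ≡.refl))

  affine-coincidences≤ : ∀ a b c d → ∑[ x < q ] δ (a + e x * b) (c + e x * d) ℕ.≤ 1 ℕ.+ q ℕ.* (δ a c ℕ.* δ b d)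
  affine-coincidences≤ a b c d with b ≟ d | a ≟ c
  ... | no b≉d | _ = ℕₚ.≤-trans (sum-𝟙-unique (λ x → _ ≟ _) λ x y eqˣ eqʸ → e-injective (affine-coincidence-unique b≉d eqˣ eqʸ))
                                (ℕₚ.m≤m+n 1 _)
  ... | yes b≈d | no a≉c = ℕₚ.≤-trans (ℕₚ.≤-reflexive (sum-zero none)) z≤n
    where
    none : ∀ x → δ (a + e x * b) (c + e x * d) ≡ 0
    none x with (a + e x * b) ≟ (c + e x * d)
    ... | yes eq = ⊥-elim (a≉c (parallel-coincidence b≈d eq))
    ... | no _ = ≡.refl
  ... | yes b≈d | yes a≈c = ℕₚ.≤-trans (sum-mono-≤ λ x → 𝟙≤1 ((a + e x * b) ≟ (c + e x * d)))
                                      (ℕₚ.≤-trans (ℕₚ.≤-reflexive (sum-const q 1)) (ℕₚ.m≤n+m _ 1))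

  sum-fibres≤ : ∀ {m} (φ : Fin m → Carrier) (W : Carrier → ℕ) → (∀ {x y} → x ≈ y → W x ≡ W y) →
                ∀ k → (∀ y → ∑[ μ < m ] δ (φ μ) y ℕ.≤ k) → ∑[ μ < m ] W (φ μ) ℕ.≤ k ℕ.* ∑[ x < q ] W (e x)
  sum-fibres≤ {m} φ W W-cong k fibre≤k = begin
    ∑[ μ < m ] W (φ μ)                                    ≡⟨ sum-cong-≗ (λ μ → sum-δ-pick (φ μ) W W-cong) ⟨
    ∑[ μ < m ] ∑[ x < q ] (δ (φ μ) (e x) ℕ.* W (e x))     ≡⟨ ∑-comm (λ μ x → δ (φ μ) (e x) ℕ.* W (e x)) ⟩
    ∑[ x < q ] ∑[ μ < m ] (δ (φ μ) (e x) ℕ.* W (e x))     ≡⟨ sum-cong-≗ (λ x → *-distribʳ-sum (W (e x)) (λ μ → δ (φ μ) (e x))) ⟨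
    ∑[ x < q ] (∑[ μ < m ] δ (φ μ) (e x) ℕ.* W (e x))     ≤⟨ sum-mono-≤ (λ x → ℕₚ.*-monoˡ-≤ (W (e x)) (fibre≤k (e x))) ⟩
    ∑[ x < q ] (k ℕ.* W (e x))                            ≡⟨ *-distribˡ-sum k (W ∘ e) ⟨
    k ℕ.* ∑[ x < q ] W (e x)                              ∎
    where open ℕₚ.≤-Reasoning

  module Lines {n} (a b : Fin n → Carrier) where

    line : Fin n → Carrier → Carrier
    line u l = a u + l * b u

    rep : Carrier → Carrier → ℕ
    rep l y = ∑[ u < n ] δ (line u l) y

    energy : Carrier → ℕ
    energy l = ∑[ u < n ] ∑[ v < n ] δ (line u l) (line v l)

    coincidences : ℕ
    coincidences = ∑[ u < n ] ∑[ v < n ] (δ (a u) (a v) ℕ.* δ (b u) (b v))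

    rep-cong : ∀ {l l′ y y′} → l ≈ l′ → y ≈ y′ → rep l y ≡ rep l′ y′
    rep-cong l≈l′ y≈y′ = sum-cong-≗ {n} λ u → δ-cong (+-congˡ (*-congʳ l≈l′)) y≈y′

    sum-rep : ∀ l → ∑[ x < q ] rep l (e x) ≡ n
    sum-rep l = begin
      ∑[ x < q ] ∑[ u < n ] δ (line u l) (e x)   ≡⟨ ∑-comm (λ x u → δ (line u l) (e x)) ⟩
      ∑[ u < n ] ∑[ x < q ] δ (line u l) (e x)   ≡⟨ sum-cong-≗ (λ u → sum-δ (line u l)) ⟩
      ∑[ u < n ] 1                               ≡⟨ sum-const n 1 ⟩
      n ℕ.* 1                                    ≡⟨ ℕₚ.*-identityʳ n ⟩
      n                                          ∎
      where open ≡.≡-Reasoning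

    sum-rep² : ∀ l → ∑[ x < q ] (rep l (e x) ℕ.* rep l (e x)) ≡ energy l
    sum-rep² l = begin
      ∑[ x < q ] (rep l (e x) ℕ.* rep l (e x))                  ≡⟨ sum-cong-≗ (λ x → *-distribʳ-sum (rep l (e x)) (λ u → δ (line u l) (e x))) ⟩
      ∑[ x < q ] ∑[ u < n ] (δ (line u l) (e x) ℕ.* rep l (e x)) ≡⟨ ∑-comm (λ x u → δ (line u l) (e x) ℕ.* rep l (e x)) ⟩
      ∑[ u < n ] ∑[ x < q ] (δ (line u l) (e x) ℕ.* rep l (e x)) ≡⟨ sum-cong-≗ (λ u → sum-δ-pick (line u l) (rep l) (rep-cong refl)) ⟩
      ∑[ u < n ] rep l (line u l)                               ≡⟨ ∑-comm (λ u v → δ (line v l) (line u l)) ⟩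
      energy l                                                  ∎
      where open ≡.≡-Reasoning

    energy-rep-cong : ∀ {l l′} → (∀ y → rep l y ≡ rep l′ y) → energy l ≡ energy l′
    energy-rep-cong {l} {l′} rep≡ = ≡.trans (≡.sym (sum-rep² l))
      (≡.trans (sum-cong-≗ λ x → ≡.cong₂ ℕ._*_ (rep≡ (e x)) (rep≡ (e x))) (sum-rep² l′))

    energy-cong : ∀ {l l′} → l ≈ l′ → energy l ≡ energy l′
    energy-cong l≈l′ = energy-rep-cong (λ y → rep-cong l≈l′ refl)

    sum-energy≤ : ∑[ x < q ] energy (e x) ℕ.≤ n ℕ.* n ℕ.+ q ℕ.* coincidences
    sum-energy≤ = begin
      ∑[ x < q ] ∑[ u < n ] ∑[ v < n ] δ (line u (e x)) (line v (e x))
        ≡⟨ ∑-comm (λ x u → ∑[ v < n ] δ (line u (e x)) (line v (e x))) ⟩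
      ∑[ u < n ] ∑[ x < q ] ∑[ v < n ] δ (line u (e x)) (line v (e x))
        ≡⟨ sum-cong-≗ (λ u → ∑-comm (λ x v → δ (line u (e x)) (line v (e x)))) ⟩
      ∑[ u < n ] ∑[ v < n ] ∑[ x < q ] δ (line u (e x)) (line v (e x))
        ≤⟨ sum-mono-≤ (λ u → sum-mono-≤ (λ v → affine-coincidences≤ (a u) (b u) (a v) (b v))) ⟩
      ∑[ u < n ] ∑[ v < n ] (1 ℕ.+ q ℕ.* K u v)
        ≡⟨ sum-cong-≗ (λ u → ∑-distrib-+ (λ _ → 1) (λ v → q ℕ.* K u v)) ⟩
      ∑[ u < n ] (∑[ v < n ] 1 ℕ.+ ∑[ v < n ] (q ℕ.* K u v))
        ≡⟨ ∑-distrib-+ (λ _ → ∑[ v < n ] 1) (λ u → ∑[ v < n ] (q ℕ.* K u v)) ⟩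
      ∑[ u < n ] ∑[ v < n ] 1 ℕ.+ ∑[ u < n ] ∑[ v < n ] (q ℕ.* K u v)
        ≡⟨ ≡.cong₂ ℕ._+_ (≡.trans (sum-cong-≗ {n} λ _ → sum-const n 1)
                                  (≡.trans (sum-const n (n ℕ.* 1)) (≡.cong (n ℕ.*_) (ℕₚ.*-identityʳ n))))
                         (≡.trans (sum-cong-≗ λ u → ≡.sym (*-distribˡ-sum q (K u)))
                                  (≡.sym (*-distribˡ-sum q (λ u → sum (K u))))) ⟩
      n ℕ.* n ℕ.+ q ℕ.* coincidences ∎
      where
      open ℕₚ.≤-Reasoning
      K : Fin n → Fin n → ℕ
      K u v = δ (a u) (a v) ℕ.* δ (b u) (b v)

module SubgroupSums {c ℓ} (F : FiniteField c ℓ) {T} (G : Subgroup F T) where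

  open FiniteField F
  open FieldAlgebra F
  open FieldSums F
  open Subgroup G
  open import Algebra.Properties.Ring ring using (-1*x≈-x; x[y-z]≈xy-xz)
  import Algebra.Solver.CommutativeMonoid *-commutativeMonoid as *-Solver
  import Relation.Binary.Reasoning.Setoid setoid as ≈-Reasoning

  private
    q = size

  s : Fin T → Carrier
  s i = g i * g i

  sum-δ-g≤1 : ∀ y → ∑[ k < T ] δ y (g k) ℕ.≤ 1
  sum-δ-g≤1 y = sum-𝟙-unique (λ k → y ≟ g k) (λ i j y≈gi y≈gj → injective i j (trans (sym y≈gi) y≈gj))

  square-roots≤2 : ∀ c → ∑[ i < T ] δ c (s i) ℕ.≤ 2
  square-roots≤2 c with Finₚ.any? (λ i → c ≟ s i)
  ... | no ∄ = ℕₚ.≤-trans (ℕₚ.≤-reflexive (sum-zero λ i → 𝟙≡0 (c ≟ s i) λ c≈sᵢ → ∄ (i , c≈sᵢ))) z≤n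
  ... | yes (i₀ , c≈sᵢ₀) = begin
    ∑[ i < T ] δ c (s i)                                           ≤⟨ sum-mono-≤ two-roots ⟩
    ∑[ i < T ] (δ (g i₀) (g i) ℕ.+ δ (- g i₀) (g i))                ≡⟨ ∑-distrib-+ (λ i → δ (g i₀) (g i)) (λ i → δ (- g i₀) (g i)) ⟩
    ∑[ i < T ] δ (g i₀) (g i) ℕ.+ ∑[ i < T ] δ (- g i₀) (g i)      ≤⟨ ℕₚ.+-mono-≤ (sum-δ-g≤1 (g i₀)) (sum-δ-g≤1 (- g i₀)) ⟩
    2                                                              ∎
    where
    open ℕₚ.≤-Reasoning
    two-roots : ∀ i → δ c (s i) ℕ.≤ δ (g i₀) (g i) ℕ.+ δ (- g i₀) (g i)
    two-roots i = 𝟙-⊎ (c ≟ s i) (g i₀ ≟ g i) ((- g i₀) ≟ g i) λ c≈sᵢ →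
      Sum.map sym sym (x²≈y²⇒x≈±y (trans (sym c≈sᵢ) c≈sᵢ₀))

  _·_ : Fin T → Fin T → Fin T
  μ · j = proj₁ (mul-closed μ j)

  ·-spec : ∀ μ j → g μ * g j ≈ g (μ · j)
  ·-spec μ j = proj₂ (mul-closed μ j)

  ·-cancel : ∀ {μ ν} → g μ * g ν ≈ 1# → ∀ j → μ · (ν · j) ≡ j
  ·-cancel {μ} {ν} μν≈1 j = injective _ _ (begin
    g (μ · (ν · j))    ≈⟨ ·-spec μ (ν · j) ⟨
    g μ * g (ν · j)    ≈⟨ *-congˡ (·-spec ν j) ⟨
    g μ * (g ν * g j)  ≈⟨ *-assoc (g μ) (g ν) (g j) ⟨
    g μ * g ν * g j    ≈⟨ *-congʳ μν≈1 ⟩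
    1# * g j           ≈⟨ *-identityˡ (g j) ⟩
    g j                ∎)
    where open ≈-Reasoning

  translation : Fin T → Permutation T T
  translation μ = permutation (μ ·_) (μ⁻¹ ·_) (·-cancel μμ⁻¹≈1) (·-cancel (trans (*-comm _ _) μμ⁻¹≈1))
    where
    μ⁻¹ = proj₁ (inv-closed μ)
    μμ⁻¹≈1 = proj₂ (inv-closed μ)

  sum-translate : ∀ μ (f : Fin T → ℕ) → ∑[ j < T ] f (μ · j) ≡ sum f
  sum-translate μ f = ≡.sym (∑-permute f (translation μ))

  ∈G-cong : ∀ {y y′} → y ≈ y′ → y ∈G → y′ ∈G
  ∈G-cong y≈y′ (k , gₖ≈y) = k , trans gₖ≈y y≈y′

  ∈G-*ˡ : ∀ μ {y} → y ∈G → (g μ * y) ∈G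
  ∈G-*ˡ μ (k , gₖ≈y) = μ · k , trans (sym (·-spec μ k)) (*-congˡ gₖ≈y)

  ∈G-*ˡ⁻¹ : ∀ μ {y} → (g μ * y) ∈G → y ∈G
  ∈G-*ˡ⁻¹ μ {y} gμy∈G = ∈G-cong cancel (∈G-*ˡ μ⁻¹ gμy∈G)
    where
    μ⁻¹ = proj₁ (inv-closed μ)
    cancel : g μ⁻¹ * (g μ * y) ≈ y
    cancel = trans (sym (*-assoc _ _ y)) (trans (*-congʳ (trans (*-comm _ _) (proj₂ (inv-closed μ)))) (*-identityˡ y))

  𝟙∈G-cong : ∀ {y y′} → y ≈ y′ → 𝟙 (y ∈G?) ≡ 𝟙 (y′ ∈G?)
  𝟙∈G-cong y≈y′ = 𝟙-cong (_ ∈G?) (_ ∈G?) (∈G-cong y≈y′) (∈G-cong (sym y≈y′))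

  𝟙∈G-*ˡ : ∀ μ y → 𝟙 ((g μ * y) ∈G?) ≡ 𝟙 (y ∈G?)
  𝟙∈G-*ˡ μ y = 𝟙-cong (_ ∈G?) (y ∈G?) (∈G-*ˡ⁻¹ μ) (∈G-*ˡ μ)

  sum-𝟙∈G : ∑[ x < q ] 𝟙 (e x ∈G?) ≡ T
  sum-𝟙∈G = begin
    ∑[ x < q ] 𝟙 (e x ∈G?)              ≡⟨ sum-cong-≗ (λ x → sum-𝟙≡𝟙-any (λ k → g k ≟ e x) distinct) ⟨
    ∑[ x < q ] ∑[ k < T ] δ (g k) (e x)  ≡⟨ ∑-comm (λ x k → δ (g k) (e x)) ⟩
    ∑[ k < T ] ∑[ x < q ] δ (g k) (e x)  ≡⟨ sum-cong-≗ (λ k → sum-δ (g k)) ⟩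
    ∑[ k < T ] 1                         ≡⟨ sum-const T 1 ⟩
    T ℕ.* 1                              ≡⟨ ℕₚ.*-identityʳ T ⟩
    T                                    ∎
    where
    open ≡.≡-Reasoning
    distinct : ∀ {y} i j → g i ≈ y → g j ≈ y → i ≡ j
    distinct i j gᵢ≈y gⱼ≈y = injective i j (trans gᵢ≈y (sym gⱼ≈y))

  -- A pair (i , j) is encoded as an index u : Fin (T * T), so that line u λ = sᵢ + λ sⱼ.
  a b : Fin (T ℕ.* T) → Carrier
  a u = s (proj₁ (remQuot {T} T u))
  b u = s (proj₂ (remQuot {T} T u))

  open Lines a b public

  rep-scale : ∀ μ l y → rep (l * s μ) y ≡ rep l y
  rep-scale μ l y = begin
    rep (l * s μ) y                                  ≡⟨ sum-remQuot T (λ p → δ (s (proj₁ p) + l * s μ * s (proj₂ p)) y) ⟩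
    ∑[ i < T ] ∑[ j < T ] δ (s i + l * s μ * s j) y  ≡⟨ sum-cong-≗ {T} (λ i → sum-cong-≗ {T} λ j → δ-cong (+-congˡ (absorb j)) refl) ⟩
    ∑[ i < T ] ∑[ j < T ] δ (s i + l * s (μ · j)) y  ≡⟨ sum-cong-≗ (λ i → sum-translate μ (λ j → δ (s i + l * s j) y)) ⟩
    ∑[ i < T ] ∑[ j < T ] δ (s i + l * s j) y        ≡⟨ sum-remQuot T (λ p → δ (s (proj₁ p) + l * s (proj₂ p)) y) ⟨
    rep l y                                          ∎
    where
    open ≡.≡-Reasoning
    absorb : ∀ j → l * s μ * s j ≈ l * s (μ · j)
    absorb j = trans (*-Solver.solve 3 (λ l m x → (l ⊕ (m ⊕ m)) ⊕ (x ⊕ x) ⊜ l ⊕ ((m ⊕ x) ⊕ (m ⊕ x))) refl l (g μ) (g j))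
                     (*-congˡ (*-cong (·-spec μ j) (·-spec μ j)))
      where open *-Solver

  energy-scale : ∀ μ l → energy (l * s μ) ≡ energy l
  energy-scale μ l = energy-rep-cong (rep-scale μ l)

  coincidences≤ : coincidences ℕ.≤ T ℕ.* T ℕ.* 4
  coincidences≤ = ℕₚ.≤-trans (sum-mono-≤ per-pair) (ℕₚ.≤-reflexive (sum-const (T ℕ.* T) 4))
    where
    per-pair : ∀ u → ∑[ v < T ℕ.* T ] (δ (a u) (a v) ℕ.* δ (b u) (b v)) ℕ.≤ 4
    per-pair u = begin
      ∑[ v < T ℕ.* T ] (δ (a u) (a v) ℕ.* δ (b u) (b v))  ≡⟨ sum-remQuot T (λ p → δ (a u) (s (proj₁ p)) ℕ.* δ (b u) (s (proj₂ p))) ⟩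
      ∑[ k < T ] ∑[ m < T ] (δ (a u) (s k) ℕ.* δ (b u) (s m)) ≡⟨ sum-*-sum (λ k → δ (a u) (s k)) (λ m → δ (b u) (s m)) ⟩
      ∑[ k < T ] δ (a u) (s k) ℕ.* ∑[ m < T ] δ (b u) (s m)  ≤⟨ ℕₚ.*-mono-≤ (square-roots≤2 (a u)) (square-roots≤2 (b u)) ⟩
      4                                                      ∎
      where open ℕₚ.≤-Reasoning

  fibre≤2 : ∀ y → ∑[ μ < T ] δ (- 1# * s μ) y ℕ.≤ 2
  fibre≤2 y = ℕₚ.≤-trans (sum-mono-≤ λ μ → 𝟙-mono ((- 1# * s μ) ≟ y) ((- 1# * y) ≟ s μ) (sym ∘ -1*x≈y⇒x≈-1*y))
                         (square-roots≤2 (- 1# * y))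

  g*diff≈s-1 : ∀ i → g i * diff i ≈ s i - 1#
  g*diff≈s-1 i = trans (x[y-z]≈xy-xz (g i) (g i) _) (+-congˡ (-‿cong (proj₂ (inverse (g i) (nonzero i)))))

  s-s∈G⇔diff∈G : ∀ j i → 𝟙 ((s (j · i) + - 1# * s j) ∈G?) ≡ 𝟙 (diff i ∈G?)
  s-s∈G⇔diff∈G j i = ≡.trans (𝟙∈G-cong factor) (𝟙∈G-*ˡ (j · (j · i)) (diff i))
    where
    open ≈-Reasoning
    factor : s (j · i) + - 1# * s j ≈ g (j · (j · i)) * diff i
    factor = begin
      s (j · i) + - 1# * s j                 ≈⟨ +-cong (*-cong (·-spec j i) (·-spec j i)) (sym (-1*x≈-x (s j))) ⟨
      (g j * g i) * (g j * g i) - s j        ≈⟨ +-cong (*-Solver.solve 2 (λ x y → (x ⊕ y) ⊕ (x ⊕ y) ⊜ (x ⊕ x) ⊕ (y ⊕ y)) refl (g j) (g i))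
                                                       (-‿cong (sym (*-identityʳ (s j)))) ⟩
      s j * s i - s j * 1#                   ≈⟨ x[y-z]≈xy-xz (s j) (s i) 1# ⟨
      s j * (s i - 1#)                       ≈⟨ *-congˡ (g*diff≈s-1 i) ⟨
      s j * (g i * diff i)                   ≈⟨ *-Solver.solve 3 (λ x y d → (x ⊕ x) ⊕ (y ⊕ d) ⊜ (x ⊕ (x ⊕ y)) ⊕ d) refl (g j) (g i) (diff i) ⟩
      g j * (g j * g i) * diff i             ≈⟨ *-congʳ (trans (*-congˡ (·-spec j i)) (·-spec j (j · i))) ⟩
      g (j · (j · i)) * diff i               ∎
      where open *-Solver using (_⊕_; _⊜_)

  sum-line-∈G : ∑[ u < T ℕ.* T ] 𝟙 (line u (- 1#) ∈G?) ≡ T ℕ.* N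
  sum-line-∈G = begin
    ∑[ u < T ℕ.* T ] 𝟙 (line u (- 1#) ∈G?)               ≡⟨ sum-remQuot T (λ p → 𝟙 ((s (proj₁ p) + - 1# * s (proj₂ p)) ∈G?)) ⟩
    ∑[ i < T ] ∑[ j < T ] 𝟙 ((s i + - 1# * s j) ∈G?)      ≡⟨ ∑-comm (λ i j → 𝟙 ((s i + - 1# * s j) ∈G?)) ⟩
    ∑[ j < T ] ∑[ i < T ] 𝟙 ((s i + - 1# * s j) ∈G?)      ≡⟨ sum-cong-≗ (λ j → sum-translate j (λ i → 𝟙 ((s i + - 1# * s j) ∈G?))) ⟨
    ∑[ j < T ] ∑[ i < T ] 𝟙 ((s (j · i) + - 1# * s j) ∈G?) ≡⟨ sum-cong-≗ (λ j → sum-cong-≗ (s-s∈G⇔diff∈G j)) ⟩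
    ∑[ j < T ] ∑[ i < T ] 𝟙 (diff i ∈G?)                  ≡⟨ sum-cong-≗ {T} (λ _ → count≡∑𝟙 (λ i → diff i ∈G?)) ⟨
    ∑[ j < T ] N                                          ≡⟨ sum-const T N ⟩
    T ℕ.* N                                               ∎
    where open ≡.≡-Reasoning

  sum-𝟙∈G*rep : ∑[ x < q ] (𝟙 (e x ∈G?) ℕ.* rep (- 1#) (e x)) ≡ T ℕ.* N
  sum-𝟙∈G*rep = begin
    ∑[ x < q ] (𝟙 (e x ∈G?) ℕ.* rep (- 1#) (e x))
      ≡⟨ sum-cong-≗ (λ x → *-distribˡ-sum (𝟙 (e x ∈G?)) (λ u → δ (line u (- 1#)) (e x))) ⟩
    ∑[ x < q ] ∑[ u < T ℕ.* T ] (𝟙 (e x ∈G?) ℕ.* δ (line u (- 1#)) (e x))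
      ≡⟨ ∑-comm (λ x u → 𝟙 (e x ∈G?) ℕ.* δ (line u (- 1#)) (e x)) ⟩
    ∑[ u < T ℕ.* T ] ∑[ x < q ] (𝟙 (e x ∈G?) ℕ.* δ (line u (- 1#)) (e x))
      ≡⟨ sum-cong-≗ (λ u → ≡.trans (sum-cong-≗ λ x → ℕₚ.*-comm (𝟙 (e x ∈G?)) _)
                                   (sum-δ-pick (line u (- 1#)) (λ y → 𝟙 (y ∈G?)) 𝟙∈G-cong)) ⟩
    ∑[ u < T ℕ.* T ] 𝟙 (line u (- 1#) ∈G?)
      ≡⟨ sum-line-∈G ⟩
    T ℕ.* N ∎
    where open ≡.≡-Reasoning

module Excess {c ℓ} (F : FiniteField c ℓ) {T} (G : Subgroup F T) where

  import Data.Nat.Tactic.RingSolver as ℕ-Solver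
  open FiniteField F using (Carrier; _≈_; size; 1#; -_; _*_)
  open FieldSums F
  open SubgroupSums F G

  private
    q = size
    n = T ℕ.* T

  n²≤q*energy : ∀ l → n ℕ.* n ℕ.≤ q ℕ.* energy l
  n²≤q*energy l = ≡.subst₂ ℕ._≤_ (≡.cong₂ ℕ._*_ (sum-rep l) (sum-rep l)) (≡.cong (q ℕ.*_) (sum-rep² l))
    (cauchy-schwarz (rep l ∘ e))

  excess : Carrier → ℕ
  excess l = q ℕ.* energy l ℕ.∸ n ℕ.* n

  excess-cong : ∀ {l l′} → l ≈ l′ → excess l ≡ excess l′
  excess-cong l≈l′ = ≡.cong (λ E → q ℕ.* E ℕ.∸ n ℕ.* n) (energy-cong l≈l′)

  excess-scale : ∀ μ l → excess (l * s μ) ≡ excess l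
  excess-scale μ l = ≡.cong (λ E → q ℕ.* E ℕ.∸ n ℕ.* n) (energy-scale μ l)

  sum-excess≤ : ∑[ x < q ] excess (e x) ℕ.≤ q ℕ.* q ℕ.* (n ℕ.* 4)
  sum-excess≤ = ℕₚ.+-cancelʳ-≤ (q ℕ.* (n ℕ.* n)) _ _ (begin
    ∑[ x < q ] excess (e x) ℕ.+ q ℕ.* (n ℕ.* n)     ≡⟨ sum-∸ (λ x → q ℕ.* energy (e x)) (n ℕ.* n) (n²≤q*energy ∘ e) ⟩
    ∑[ x < q ] (q ℕ.* energy (e x))                ≡⟨ *-distribˡ-sum q (energy ∘ e) ⟨
    q ℕ.* ∑[ x < q ] energy (e x)                  ≤⟨ ℕₚ.*-monoʳ-≤ q sum-energy≤ ⟩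
    q ℕ.* (n ℕ.* n ℕ.+ q ℕ.* coincidences)         ≤⟨ ℕₚ.*-monoʳ-≤ q (ℕₚ.+-monoʳ-≤ (n ℕ.* n) (ℕₚ.*-monoʳ-≤ q coincidences≤)) ⟩
    q ℕ.* (n ℕ.* n ℕ.+ q ℕ.* (n ℕ.* 4))            ≡⟨ rearrange q (n ℕ.* n) (n ℕ.* 4) ⟩
    q ℕ.* q ℕ.* (n ℕ.* 4) ℕ.+ q ℕ.* (n ℕ.* n)      ∎)
    where
    open ℕₚ.≤-Reasoning
    rearrange : ∀ q a b → q ℕ.* (a ℕ.+ q ℕ.* b) ≡ q ℕ.* q ℕ.* b ℕ.+ q ℕ.* a
    rearrange = ℕ-Solver.solve-∀

  T*excess≤ : T ℕ.* excess (- 1#) ℕ.≤ 2 ℕ.* (q ℕ.* q ℕ.* (n ℕ.* 4))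
  T*excess≤ = begin
    T ℕ.* excess (- 1#)                   ≡⟨ sum-const T (excess (- 1#)) ⟨
    ∑[ μ < T ] excess (- 1#)              ≡⟨ sum-cong-≗ (λ μ → excess-scale μ (- 1#)) ⟨
    ∑[ μ < T ] excess (- 1# * s μ)        ≤⟨ sum-fibres≤ (λ μ → - 1# * s μ) excess excess-cong 2 fibre≤2 ⟩
    2 ℕ.* ∑[ x < q ] excess (e x)         ≤⟨ ℕₚ.*-monoʳ-≤ 2 sum-excess≤ ⟩
    2 ℕ.* (q ℕ.* q ℕ.* (n ℕ.* 4))         ∎
    where open ℕₚ.≤-Reasoning

module Variance {c ℓ} (F : FiniteField c ℓ) {T} (G : Subgroup F T) where

  open import Data.Integer using (_+_; _*_; _-_; -_; _≤_; 0ℤ)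
  open import Data.Integer.Tactic.RingSolver using (solve-∀)
  open FiniteField F using (size; 1#) renaming (-_ to -ᶠ_)
  open FieldSums F
  open SubgroupSums F G
  open Subgroup G using (N; _∈G?)
  open Excess F G

  private
    q = size
    n = T ℕ.* T
    r : Fin q → ℕ
    r x = rep (-ᶠ 1#) (e x)
    w : Fin q → ℕ
    w x = 𝟙 (e x ∈G?)

  X : ℤ
  X = + (q ℕ.* N) - + n

  d : Fin q → ℤ
  d x = + q * + r x - + n

  mean : sumℤ (λ x → + w x * d x) ≡ + sum w * X
  mean = begin
    sumℤ (λ x → + w x * d x)                                          ≡⟨ sumℤ-cong pointwise ⟩
    sumℤ (λ x → + q * + (w x ℕ.* r x) + - + n * + w x)                ≡⟨ sumℤ-linear₂ (+ q) (- + n) (λ x → + (w x ℕ.* r x)) (λ x → + w x) ⟩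
    + q * sumℤ (λ x → + (w x ℕ.* r x)) + - + n * sumℤ (λ x → + w x)   ≡⟨ ≡.cong₂ (λ A B → + q * A + - + n * B)
                                                                            (≡.trans (sumℤ-+ (λ x → w x ℕ.* r x)) (≡.cong +_ sum-𝟙∈G*rep))
                                                                            (≡.trans (sumℤ-+ w) (≡.cong +_ sum-𝟙∈G)) ⟩
    + q * + (T ℕ.* N) + - + n * + T                                   ≡⟨ ≡.cong₂ (λ A B → + q * A + - B * + T) (ℤₚ.pos-* T N) (ℤₚ.pos-* T T) ⟩
    + q * (+ T * + N) + - (+ T * + T) * + T                           ≡⟨ factor (+ q) (+ T) (+ N) ⟩
    + T * (+ q * + N - + T * + T)                                     ≡⟨ ≡.cong₂ (λ A B → + T * (A - B)) (ℤₚ.pos-* q N) (ℤₚ.pos-* T T) ⟨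
    + T * X                                                           ≡⟨ ≡.cong (λ W → + W * X) sum-𝟙∈G ⟨
    + sum w * X                                                       ∎
    where
    open ≡.≡-Reasoning
    distribute : ∀ Q M W R → W * (Q * R - M) ≡ Q * (W * R) + - M * W
    distribute = solve-∀
    factor : ∀ Q T N → Q * (T * N) + - (T * T) * T ≡ T * (Q * N - T * T)
    factor = solve-∀
    pointwise : ∀ x → + w x * d x ≡ + q * + (w x ℕ.* r x) + - + n * + w x
    pointwise x = ≡.trans (distribute (+ q) (+ n) (+ w x) (+ r x))
                          (≡.cong (λ y → + q * y + - + n * + w x) (≡.sym (ℤₚ.pos-* (w x) (r x))))

  +excess : ∀ l → + excess l ≡ + q * + energy l - + n * + n
  +excess l = begin
    + (q ℕ.* energy l ℕ.∸ n ℕ.* n)          ≡⟨ ℤₚ.⊖-≥ (n²≤q*energy l) ⟨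
    q ℕ.* energy l ℤ.⊖ n ℕ.* n              ≡⟨ ℤₚ.m-n≡m⊖n (q ℕ.* energy l) (n ℕ.* n) ⟨
    + (q ℕ.* energy l) - + (n ℕ.* n)        ≡⟨ ≡.cong₂ _-_ (ℤₚ.pos-* q (energy l)) (ℤₚ.pos-* n n) ⟩
    + q * + energy l - + n * + n            ∎
    where open ≡.≡-Reasoning

  T*X²≤q*excess : + T * (X * X) ≤ + (q ℕ.* excess (-ᶠ 1#))
  T*X²≤q*excess = begin
    + T * (X * X)                                          ≡⟨ ≡.cong (λ W → + W * (X * X)) sum-𝟙∈G ⟨
    + sum w * (X * X)                                      ≤⟨ weighted-mean-sq≤ w d X mean ⟩
    sumℤ (λ x → + w x * (d x * d x))                       ≤⟨ sumℤ-mono-≤ (λ x → +m*i≤i (w x) (𝟙≤1 (e x ∈G?)) (0≤i*i (d x))) ⟩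
    sumℤ (λ x → d x * d x)
      ≡⟨ ≡.cong (λ m → sumℤ (λ x → (+ q * + r x - + m) * (+ q * + r x - + m))) (sum-rep (-ᶠ 1#)) ⟨
    sumℤ (λ x → (+ q * + r x - + sum r) * (+ q * + r x - + sum r))
                                                           ≡⟨ sumℤ-sq-deviation r ⟩
    + q * (+ q * + sum (λ x → r x ℕ.* r x) - + sum r * + sum r)
                                                           ≡⟨ ≡.cong₂ (λ E m → + q * (+ q * + E - + m * + m)) (sum-rep² (-ᶠ 1#)) (sum-rep (-ᶠ 1#)) ⟩
    + q * (+ q * + energy (-ᶠ 1#) - + n * + n)             ≡⟨ ≡.cong (+ q *_) (+excess (-ᶠ 1#)) ⟨
    + q * + excess (-ᶠ 1#)                                 ≡⟨ ℤₚ.pos-* q _ ⟨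
    + (q ℕ.* excess (-ᶠ 1#))                               ∎
    where open ℤₚ.≤-Reasoning

open import Data.Nat using (_≤_; _*_; _∸_; _^_)

-- The argument works in every finite field.
proposition2p7 : ∀ {c ℓ : Level} (F : FiniteField c ℓ) → IsPrimePower (FiniteField.size F) →
    (T : ℕ) (G : Subgroup F T) →
    let q = FiniteField.size F
        N = Subgroup.N G
    in (T * T ∸ q * N) ^ 2 ≤ 9 * q ^ 3
proposition2p7 F _ T G =
  square-bound (FiniteField.size F) T (Subgroup.N G) (excess (- 1#)) T*X²≤q*excess T*excess≤
  where
  open FiniteField F using (-_; 1#)
  open Excess F G
  open Variance F G
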